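{- Let $h \geq 1$ be an integer and let $i_0$ be an integer with $0 \leq i_0 \leq h-1$. Let \[ p = 1 + (i_0-1)(h+1) \qquad\text{and}\qquad c = h^2 + h + 1 - p = (h+1-i_0)(h+1), \] and let $A = \{0,1,h+1,c\}$. Then $|A| = 4$ and \[ |hA| = \binom{h+3}{3} - \binom{i_0+2}{3}. \]
   Context: For a set $A$ of integers and a positive integer $h$, the $h$-fold sumset $hA$ is the set of all sums $a_1 + a_2 + \cdots + a_h$ with $a_1,\ldots,a_h \in A$ (not necessarily distinct). $|X|$ denotes the cardinality of a finite set $X$. Binomial coefficients follow the standard convention $\binom{n}{3} = 0$ for integers $0 \leq n < 3$. -}

module Defs where

open import Data.Nat as ℕ using (ℕ; zero; suc)
open import Data.Integer as ℤ using (ℤ; _+_; _-_; _*_; +_)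
open import Data.List using (List; []; _∷_; map; concatMap; length; deduplicate)

sumsList : ℕ → List ℤ → List ℤ
sumsList zero    A = (+ 0) ∷ []
sumsList (suc h) A = concatMap (λ s → map (λ a → s + a) A) (sumsList h A)

card : List ℤ → ℕ
card xs = length (deduplicate ℤ._≟_ xs)

sumsetCard : ℕ → List ℤ → ℕ
sumsetCard h A = card (sumsList h A)

-- p = 1 + (i₀ - 1)(h + 1)   (an integer; negative when i₀ = 0)
pVal : ℕ → ℕ → ℤ
pVal h i₀ = + 1 + (+ i₀ - + 1) * (+ h + + 1)

cVal : ℕ → ℕ → ℤ
cVal h i₀ = + h * + h + + h + + 1 - pVal h i₀

setA : ℕ → ℕ → List ℤ
setA h i₀ = + 0 ∷ + 1 ∷ + (suc h) ∷ cVal h i₀ ∷ []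

{-# OPTIONS --safe #-}
module Submission where

-- Put e = h + 1 and k = h + 1 − i₀, so that c = k·e. A sum of h elements of A is
-- x + y·e + z·k·e with x + y + z ≤ h; writing y + z·k = r + q·k with r < k, the greedy
-- choice gives r + q ≤ y + z. Hence, reading w = x + (r + q·k)·e in the mixed radix
-- (e, k), the sumset hA is exactly the set of w whose digit sum x + r + q is at most h.
-- Counting digit triples gives Σ_{r<k} C(h + 2 − r, 2), which the hockey-stick identity
-- turns into C(h + 3, 3) − C(h + 3 − k, 3), and h + 3 − k = i₀ + 2.

open import Defs
open import Algebra.Properties.CommutativeSemigroup as CommSemigroupProperties using ()
open import Data.Bool.Base using (true; false; if_then_else_)
open import Data.Integer as ℤ using (ℤ; +_)
open import Data.Integer.Properties using (+-injective; pos-*)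
open import Data.Integer.Tactic.RingSolver as ℤ-Solver using ()
open import Data.List.Base using (List; []; _∷_; map; length; filter; downFrom)
open import Data.List.Properties using (length-map)
open import Data.List.Membership.Propositional using (_∈_; find; lose)
open import Data.List.Membership.Propositional.Properties using (∈-map⁺; ∈-map⁻; ∈-concatMap⁺; ∈-concatMap⁻; ∈-filter⁺; ∈-filter⁻; ∈-downFrom⁺; ∈-deduplicate⁺; ∈-deduplicate⁻)
open import Data.List.Membership.Propositional.Properties.WithK using (unique∧set⇒bag)
open import Data.List.Relation.Binary.BagAndSetEquality using (∼bag⇒↭)
open import Data.List.Relation.Binary.Permutation.Propositional.Properties using (↭-length)
open import Data.List.Relation.Unary.All using ([]; _∷_)
open import Data.List.Relation.Unary.AllPairs using ([]; _∷_)
open import Data.List.Relation.Unary.Any using (here; there)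
open import Data.List.Relation.Unary.Unique.Propositional using (Unique)
open import Data.List.Relation.Unary.Unique.Propositional.Properties using (map⁺; filter⁺; downFrom⁺)
open import Data.List.Relation.Unary.Unique.DecPropositional.Properties ℤ._≟_ using (deduplicate-!)
open import Data.Nat using (ℕ; zero; suc; _≤_; _<_; _+_; _∸_; _*_; _⊓_; z≤n; s≤s; z<s; NonZero)
open import Data.Nat.Properties
open import Data.Nat.Combinatorics using (_C_; nC1≡n; nCk+nC[k+1]≡[n+1]C[k+1]; k>n⇒nCk≡0)
open import Data.Nat.Divisibility using (n∣m*n)
open import Data.Nat.DivMod using (_%_; _/_; m≡m%n+[m/n]*n; m%n<n; [m+kn]%n≡m%n; m<n⇒m%n≡m; m<n⇒m/n≡0; m*n/n≡m; +-distrib-/-∣ʳ)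
open import Data.Nat.Tactic.RingSolver using (solve-∀)
open import Data.Product using (_×_; _,_; proj₂; ∃-syntax)
open import Function.Bundles using (mk⇔)
open import Relation.Binary.PropositionalEquality using (_≡_; _≢_; refl; sym; trans; cong; cong₂; subst; module ≡-Reasoning)
open import Relation.Nullary using (Dec; does; yes; no; ¬_; contradiction)
open import Relation.Unary using (Pred; Decidable)

open CommSemigroupProperties +-commutativeSemigroup using (x∙yz≈y∙xz; xy∙z≈y∙xz)

∑< : ℕ → (ℕ → ℕ) → ℕ
∑< zero    f = 0
∑< (suc n) f = f n + ∑< n f

syntax ∑< n (λ i → t) = ∑[ i < n ] t

∑-cong : ∀ {f g : ℕ → ℕ} n → (∀ i → i < n → f i ≡ g i) → ∑< n f ≡ ∑< n g
∑-cong zero    f≗g = refl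
∑-cong (suc n) f≗g = cong₂ _+_ (f≗g n ≤-refl) (∑-cong n (λ i i<n → f≗g i (m<n⇒m<1+n i<n)))

∑-zero : ∀ n → ∑[ i < n ] 0 ≡ 0
∑-zero zero    = refl
∑-zero (suc n) = ∑-zero n

∑-distrib-+ : ∀ (f g : ℕ → ℕ) n → ∑[ i < n ] (f i + g i) ≡ ∑< n f + ∑< n g
∑-distrib-+ f g zero    = refl
∑-distrib-+ f g (suc n) = begin
  f n + g n + ∑[ i < n ] (f i + g i) ≡⟨ cong (_+_ (f n + g n)) (∑-distrib-+ f g n) ⟩
  f n + g n + (∑< n f + ∑< n g)      ≡⟨ +-assoc (f n) (g n) _ ⟩
  f n + (g n + (∑< n f + ∑< n g))    ≡⟨ cong (_+_ (f n)) (x∙yz≈y∙xz (g n) (∑< n f) (∑< n g)) ⟩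
  f n + (∑< n f + (g n + ∑< n g))    ≡⟨ +-assoc (f n) (∑< n f) _ ⟨
  f n + ∑< n f + (g n + ∑< n g)      ∎
  where open ≡-Reasoning

∑-comm : ∀ (f : ℕ → ℕ → ℕ) m n → ∑[ a < m ] ∑[ b < n ] f a b ≡ ∑[ b < n ] ∑[ a < m ] f a b
∑-comm f zero    n = sym (∑-zero n)
∑-comm f (suc m) n = trans (cong (_+_ (∑< n (f m))) (∑-comm f m n))
                           (sym (∑-distrib-+ (f m) (λ b → ∑[ a < m ] f a b) n))

∑-split : ∀ (f : ℕ → ℕ) m n → ∑[ i < m + n ] f i ≡ ∑[ x < m ] f (x + n) + ∑< n f
∑-split f zero    n = refl
∑-split f (suc m) n = trans (cong (_+_ (f (m + n))) (∑-split f m n))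
                            (sym (+-assoc (f (m + n)) _ _))

∑-blocks : ∀ (f : ℕ → ℕ) m n → ∑[ i < m * n ] f i ≡ ∑[ a < m ] ∑[ x < n ] f (x + a * n)
∑-blocks f zero    n = refl
∑-blocks f (suc m) n = trans (∑-split f n (m * n))
                             (cong (_+_ (∑[ x < n ] f (x + m * n))) (∑-blocks f m n))

𝟙 : ∀ {p} {P : Set p} → Dec P → ℕ
𝟙 P? = if does P? then 1 else 0

𝟙-yes : ∀ {p} {P : Set p} (P? : Dec P) → P → 𝟙 P? ≡ 1
𝟙-yes (yes _) _ = refl
𝟙-yes (no ¬p) p = contradiction p ¬p

𝟙-no : ∀ {p} {P : Set p} (P? : Dec P) → ¬ P → 𝟙 P? ≡ 0
𝟙-no (yes p) ¬p = contradiction p ¬p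
𝟙-no (no _)  _  = refl

length-filter-downFrom : ∀ {p} {P : Pred ℕ p} (P? : Decidable P) n →
                         length (filter P? (downFrom n)) ≡ ∑[ i < n ] 𝟙 (P? i)
length-filter-downFrom P? zero = refl
length-filter-downFrom P? (suc n) with does (P? n)
... | true  = cong suc (length-filter-downFrom P? n)
... | false = length-filter-downFrom P? n

∑-𝟙-+≤ : ∀ h c n → ∑[ x < n ] 𝟙 (x + c ≤? h) ≡ n ⊓ (suc h ∸ c)
∑-𝟙-+≤ h c zero    = refl
∑-𝟙-+≤ h c (suc n) with n + c ≤? h
... | yes n+c≤h = begin
  𝟙 (n + c ≤? h) + ∑[ x < n ] 𝟙 (x + c ≤? h) ≡⟨ cong (_+ ∑[ x < n ] 𝟙 (x + c ≤? h)) (𝟙-yes (n + c ≤? h) n+c≤h) ⟩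
  suc (∑[ x < n ] 𝟙 (x + c ≤? h))            ≡⟨ cong suc (∑-𝟙-+≤ h c n) ⟩
  suc (n ⊓ (suc h ∸ c))                      ≡⟨ cong suc (m≤n⇒m⊓n≡m (<⇒≤ n<b)) ⟩
  suc n                                      ≡⟨ m≤n⇒m⊓n≡m n<b ⟨
  suc n ⊓ (suc h ∸ c)                        ∎
  where open ≡-Reasoning
        n<b : n < suc h ∸ c
        n<b = m+n≤o⇒m≤o∸n (suc n) (s≤s n+c≤h)
... | no n+c≰h = begin
  𝟙 (n + c ≤? h) + ∑[ x < n ] 𝟙 (x + c ≤? h) ≡⟨ cong (_+ ∑[ x < n ] 𝟙 (x + c ≤? h)) (𝟙-no (n + c ≤? h) n+c≰h) ⟩
  ∑[ x < n ] 𝟙 (x + c ≤? h)                  ≡⟨ ∑-𝟙-+≤ h c n ⟩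
  n ⊓ (suc h ∸ c)                            ≡⟨ m≥n⇒m⊓n≡n b≤n ⟩
  suc h ∸ c                                  ≡⟨ m≥n⇒m⊓n≡n (m≤n⇒m≤1+n b≤n) ⟨
  suc n ⊓ (suc h ∸ c)                        ∎
  where open ≡-Reasoning
        b≤n : suc h ∸ c ≤ n
        b≤n = m≤n+o⇒m∸n≤o (suc h) c (subst (suc h ≤_) (+-comm n c) (≰⇒> n+c≰h))

-- No bound on k is needed: for r > n the summands are 0 C (1 + j) = 0, which is why the
-- lower index is a successor.
hockey-stick : ∀ j n k → ∑[ r < k ] ((n ∸ r) C suc j) + (suc n ∸ k) C (2 + j) ≡ suc n C (2 + j)
hockey-stick j n zero    = refl
hockey-stick j n (suc k) with k ≤? n
... | yes k≤n = begin
  (n ∸ k) C suc j + S + (n ∸ k) C (2 + j)   ≡⟨ xy∙z≈y∙xz ((n ∸ k) C suc j) S _ ⟩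
  S + ((n ∸ k) C suc j + (n ∸ k) C (2 + j)) ≡⟨ cong (_+_ S) (nCk+nC[k+1]≡[n+1]C[k+1] (n ∸ k) (suc j)) ⟩
  S + suc (n ∸ k) C (2 + j)                 ≡⟨ cong (λ t → S + t C (2 + j)) (+-∸-assoc 1 k≤n) ⟨
  S + (suc n ∸ k) C (2 + j)                 ≡⟨ hockey-stick j n k ⟩
  suc n C (2 + j)                           ∎
  where open ≡-Reasoning
        S = ∑[ r < k ] ((n ∸ r) C suc j)
... | no k≰n = begin
  (n ∸ k) C suc j + S + (n ∸ k) C (2 + j)   ≡⟨ cong (λ t → t C suc j + S + t C (2 + j)) (m≤n⇒m∸n≡0 (<⇒≤ n<k)) ⟩
  S + 0                                     ≡⟨ cong (λ t → S + t C (2 + j)) (m≤n⇒m∸n≡0 n<k) ⟨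
  S + (suc n ∸ k) C (2 + j)                 ≡⟨ hockey-stick j n k ⟩
  suc n C (2 + j)                           ∎
  where open ≡-Reasoning
        S = ∑[ r < k ] ((n ∸ r) C suc j)
        n<k : n < k
        n<k = ≰⇒> k≰n

∑-∸ : ∀ {n b} → n ≤ b → ∑[ q < b ] (n ∸ q) ≡ suc n C 2
∑-∸ {n} {b} n≤b = begin
  ∑[ q < b ] (n ∸ q)                         ≡⟨ ∑-cong b (λ q _ → nC1≡n (n ∸ q)) ⟨
  ∑[ q < b ] ((n ∸ q) C 1)                   ≡⟨ +-identityʳ _ ⟨
  ∑[ q < b ] ((n ∸ q) C 1) + 0               ≡⟨ cong (_+_ (∑[ q < b ] ((n ∸ q) C 1))) (k>n⇒nCk≡0 tail<2) ⟨
  ∑[ q < b ] ((n ∸ q) C 1) + (suc n ∸ b) C 2 ≡⟨ hockey-stick 0 n b ⟩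
  suc n C 2                                  ∎
  where open ≡-Reasoning
        tail<2 : suc n ∸ b < 2
        tail<2 = s≤s (≤-trans (∸-monoʳ-≤ (suc n) n≤b) (≤-reflexive (m+n∸n≡m 1 n)))

module _ {n : ℕ} .{{_ : NonZero n}} where

  [m+kn]%n≡m : ∀ {m} k → m < n → (m + k * n) % n ≡ m
  [m+kn]%n≡m {m} k m<n = trans ([m+kn]%n≡m%n m k n) (m<n⇒m%n≡m m<n)

  [m+kn]/n≡k : ∀ {m} k → m < n → (m + k * n) / n ≡ k
  [m+kn]/n≡k {m} k m<n = begin
    (m + k * n) / n   ≡⟨ +-distrib-/-∣ʳ m (n∣m*n k) ⟩
    m / n + k * n / n ≡⟨ cong₂ _+_ (m<n⇒m/n≡0 m<n) (m*n/n≡m k n) ⟩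
    k                 ∎
    where open ≡-Reasoning

  m%n+m/n≤m : ∀ m → m % n + m / n ≤ m
  m%n+m/n≤m m = begin
    m % n + m / n     ≤⟨ +-monoʳ-≤ (m % n) (m≤m*n (m / n) n) ⟩
    m % n + m / n * n ≡⟨ m≡m%n+[m/n]*n m n ⟨
    m                 ∎
    where open ≤-Reasoning

  m<n⇒k<o⇒m+k*n<o*n : ∀ {m k o} → m < n → k < o → m + k * n < o * n
  m<n⇒k<o⇒m+k*n<o*n {m} {k} m<n k<o = <-≤-trans (+-monoˡ-< (k * n) m<n) (*-monoˡ-≤ n k<o)

card≡length : ∀ {xs ys : List ℤ} → Unique ys →
              (∀ {v} → v ∈ xs → v ∈ ys) → (∀ {v} → v ∈ ys → v ∈ xs) → card xs ≡ length ys
card≡length {xs} ys! xs⊆ys ys⊆xs = ↭-length (∼bag⇒↭ (unique∧set⇒bag (deduplicate-! xs) ys!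
  (mk⇔ (λ v∈ → xs⊆ys (∈-deduplicate⁻ ℤ._≟_ xs v∈)) (λ v∈ → ∈-deduplicate⁺ ℤ._≟_ (ys⊆xs v∈)))))

∈-sumsList-suc⁻ : ∀ {n A v} → v ∈ sumsList (suc n) A →
                  ∃[ s ] ∃[ a ] s ∈ sumsList n A × a ∈ A × v ≡ s ℤ.+ a
∈-sumsList-suc⁻ {n} {A} v∈
  with s , s∈ , v∈s+A ← find (∈-concatMap⁻ (λ s → map (λ a → s ℤ.+ a) A) {xs = sumsList n A} v∈)
  with a , a∈ , refl ← ∈-map⁻ (λ a → s ℤ.+ a) v∈s+A
  = s , a , s∈ , a∈ , refl

∈-sumsList-suc⁺ : ∀ {n A s a} → s ∈ sumsList n A → a ∈ A → s ℤ.+ a ∈ sumsList (suc n) A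
∈-sumsList-suc⁺ {A = A} {s} s∈ a∈ =
  ∈-concatMap⁺ (λ s → map (λ a → s ℤ.+ a) A) (lose s∈ (∈-map⁺ (λ a → s ℤ.+ a) a∈))

private
  +e-step : ∀ x y z e c → x + y * e + z * c + e ≡ x + suc y * e + z * c
  +e-step = solve-∀

  +c-step : ∀ x y z e c → x + y * e + z * c + c ≡ x + y * e + suc z * c
  +c-step = solve-∀

module Sumset-0-1-e-c (e c : ℕ) where

  A : List ℤ
  A = + 0 ∷ + 1 ∷ + e ∷ + c ∷ []

  ∈-sumsList⁻ : ∀ n {v} → v ∈ sumsList n A →
                ∃[ x ] ∃[ y ] ∃[ z ] x + (y + z) ≤ n × v ≡ + (x + y * e + z * c)
  ∈-sumsList⁻ zero (here refl) = 0 , 0 , 0 , z≤n , refl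
  ∈-sumsList⁻ (suc n) v∈
    with s , a , s∈ , a∈ , refl ← ∈-sumsList-suc⁻ {n} {A} v∈
    with x , y , z , x+y+z≤n , refl ← ∈-sumsList⁻ n s∈
    with a∈
  ... | here refl =
    x , y , z , m≤n⇒m≤1+n x+y+z≤n , cong +_ (+-identityʳ _)
  ... | there (here refl) =
    suc x , y , z , s≤s x+y+z≤n , cong +_ (+-comm _ 1)
  ... | there (there (here refl)) =
    x , suc y , z , subst (_≤ suc n) (sym (+-suc x (y + z))) (s≤s x+y+z≤n) ,
    cong +_ (+e-step x y z e c)
  ... | there (there (there (here refl))) =
    x , y , suc z , subst (_≤ suc n) (sym (trans (cong (_+_ x) (+-suc y z)) (+-suc x (y + z)))) (s≤s x+y+z≤n) ,
    cong +_ (+c-step x y z e c)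

  ∈-sumsList⁺ : ∀ n x y z → x + (y + z) ≤ n → + (x + y * e + z * c) ∈ sumsList n A
  ∈-sumsList⁺ zero    zero    zero    zero    z≤n = here refl
  ∈-sumsList⁺ (suc n) zero    zero    zero    _ =
    ∈-sumsList-suc⁺ {n} {A} (∈-sumsList⁺ n 0 0 0 z≤n) (here refl)
  ∈-sumsList⁺ (suc n) (suc x) y       z       (s≤s x+y+z≤n) =
    subst (_∈ sumsList (suc n) A) (cong +_ (+-comm _ 1))
      (∈-sumsList-suc⁺ {n} {A} (∈-sumsList⁺ n x y z x+y+z≤n) (there (here refl)))
  ∈-sumsList⁺ (suc n) zero    (suc y) z       (s≤s y+z≤n) =
    subst (_∈ sumsList (suc n) A) (cong +_ (+e-step 0 y z e c))
      (∈-sumsList-suc⁺ {n} {A} (∈-sumsList⁺ n 0 y z y+z≤n) (there (there (here refl))))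
  ∈-sumsList⁺ (suc n) zero    zero    (suc z) (s≤s z≤n′) =
    subst (_∈ sumsList (suc n) A) (cong +_ (+c-step 0 0 z e c))
      (∈-sumsList-suc⁺ {n} {A} (∈-sumsList⁺ n 0 0 z z≤n′) (there (there (there (here refl)))))

  card-A : 1 < e → e < c → card A ≡ 4
  card-A 1<e e<c = card≡length A-unique (λ v∈ → v∈) (λ v∈ → v∈)
    where
      <⇒+≢ : ∀ {m n} → m < n → + m ≢ + n
      <⇒+≢ m<n eq = <⇒≢ m<n (+-injective eq)
      0<e : 0 < e
      0<e = <-trans z<s 1<e
      A-unique : Unique A
      A-unique = (<⇒+≢ z<s ∷ <⇒+≢ 0<e ∷ <⇒+≢ (<-trans 0<e e<c) ∷ []) ∷
                 (<⇒+≢ 1<e ∷ <⇒+≢ (<-trans 1<e e<c) ∷ []) ∷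
                 (<⇒+≢ e<c ∷ []) ∷ [] ∷ []

private
  regroup : ∀ x y z k e → x + y * e + z * (k * e) ≡ x + (y + z * k) * e
  regroup = solve-∀

module PlaceValue (h k : ℕ) .{{_ : NonZero k}} where

  e : ℕ
  e = suc h

  open Sumset-0-1-e-c e (k * e) public using (A; card-A)
  open Sumset-0-1-e-c e (k * e) using (∈-sumsList⁻; ∈-sumsList⁺)

  weight : ℕ → ℕ
  weight w = w % e + (w / e % k + w / e / k)

  weight-digits : ∀ {x r} q → x < e → r < k → weight (x + (r + q * k) * e) ≡ x + (r + q)
  weight-digits {x} {r} q x<e r<k
    rewrite [m+kn]%n≡m (r + q * k) x<e | [m+kn]/n≡k (r + q * k) x<e
          | [m+kn]%n≡m q r<k | [m+kn]/n≡k q r<k = refl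

  weight-combination : ∀ {x} y z → x < e → weight (x + y * e + z * (k * e)) ≤ x + (y + z)
  weight-combination {x} y z x<e = begin
    weight (x + y * e + z * (k * e))             ≡⟨ cong weight (regroup x y z k e) ⟩
    weight (x + (y + z * k) * e)                 ≡⟨ cong (λ t → weight (x + (t + z * k) * e)) (m≡m%n+[m/n]*n y k) ⟩
    weight (x + (y % k + y / k * k + z * k) * e) ≡⟨ cong (λ t → weight (x + t * e)) y%k+[y/k+z]*k ⟩
    weight (x + (y % k + (y / k + z) * k) * e)   ≡⟨ weight-digits (y / k + z) x<e (m%n<n y k) ⟩
    x + (y % k + (y / k + z))                    ≡⟨ cong (_+_ x) (+-assoc (y % k) (y / k) z) ⟨
    x + (y % k + y / k + z)                      ≤⟨ +-monoʳ-≤ x (+-monoˡ-≤ z (m%n+m/n≤m y)) ⟩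
    x + (y + z)                                  ∎
    where open ≤-Reasoning
          y%k+[y/k+z]*k : y % k + y / k * k + z * k ≡ y % k + (y / k + z) * k
          y%k+[y/k+z]*k = trans (+-assoc (y % k) _ _) (cong (_+_ (y % k)) (sym (*-distribʳ-+ k (y / k) z)))

  weight≤h⇒< : ∀ w → weight w ≤ h → w < e * k * e
  weight≤h⇒< w weight≤h = begin-strict
    w                 ≡⟨ m≡m%n+[m/n]*n w e ⟩
    w % e + w / e * e <⟨ m<n⇒k<o⇒m+k*n<o*n (m%n<n w e) a<e*k ⟩
    e * k * e         ∎
    where open ≤-Reasoning
          a = w / e
          a/k<e : a / k < e
          a/k<e = s≤s (≤-trans (≤-trans (m≤n+m (a / k) (a % k)) (m≤n+m _ (w % e))) weight≤h)
          a<e*k : a < e * k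
          a<e*k = subst (_< e * k) (sym (m≡m%n+[m/n]*n a k)) (m<n⇒k<o⇒m+k*n<o*n (m%n<n a k) a/k<e)

  weight≤h? : Decidable (λ w → weight w ≤ h)
  weight≤h? w = weight w ≤? h

  sumset : List ℕ
  sumset = filter weight≤h? (downFrom (e * k * e))

  ∈-sumsList⇒∈-sumset : ∀ {v} → v ∈ sumsList h A → v ∈ map +_ sumset
  ∈-sumsList⇒∈-sumset v∈ with x , y , z , x+y+z≤h , refl ← ∈-sumsList⁻ h v∈ =
    ∈-map⁺ +_ (∈-filter⁺ weight≤h? (∈-downFrom⁺ (weight≤h⇒< _ weight≤h)) weight≤h)
    where x<e : x < e
          x<e = s≤s (≤-trans (m≤m+n x (y + z)) x+y+z≤h)
          weight≤h = ≤-trans (weight-combination y z x<e) x+y+z≤h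

  ∈-sumset⇒∈-sumsList : ∀ {v} → v ∈ map +_ sumset → v ∈ sumsList h A
  ∈-sumset⇒∈-sumsList v∈ with w , w∈ , refl ← ∈-map⁻ +_ v∈ =
    subst (λ t → + t ∈ sumsList h A) (sym w≡) (∈-sumsList⁺ h x r q weight≤h)
    where x = w % e
          r = w / e % k
          q = w / e / k
          weight≤h : x + (r + q) ≤ h
          weight≤h = proj₂ (∈-filter⁻ weight≤h? {xs = downFrom (e * k * e)} w∈)
          w≡ : w ≡ x + r * e + q * (k * e)
          w≡ = begin
            w                       ≡⟨ m≡m%n+[m/n]*n w e ⟩
            x + w / e * e           ≡⟨ cong (λ t → x + t * e) (m≡m%n+[m/n]*n (w / e) k) ⟩
            x + (r + q * k) * e     ≡⟨ regroup x r q k e ⟨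
            x + r * e + q * (k * e) ∎
            where open ≡-Reasoning

  sumsetCard≡∑ : sumsetCard h A ≡ ∑[ w < e * k * e ] 𝟙 (weight≤h? w)
  sumsetCard≡∑ = begin
    card (sumsList h A)                ≡⟨ card≡length sumset-unique ∈-sumsList⇒∈-sumset ∈-sumset⇒∈-sumsList ⟩
    length (map +_ sumset)             ≡⟨ length-map +_ sumset ⟩
    length sumset                      ≡⟨ length-filter-downFrom weight≤h? (e * k * e) ⟩
    ∑[ w < e * k * e ] 𝟙 (weight≤h? w) ∎
    where open ≡-Reasoning
          sumset-unique : Unique (map +_ sumset)
          sumset-unique = map⁺ +-injective (filter⁺ weight≤h? (downFrom⁺ (e * k * e)))

  ∑-weight : ∑[ w < e * k * e ] 𝟙 (weight≤h? w) ≡ ∑[ r < k ] (suc (e ∸ r) C 2)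
  ∑-weight = begin
    ∑[ w < e * k * e ] 𝟙 (weight≤h? w)
      ≡⟨ ∑-blocks _ (e * k) e ⟩
    ∑[ a < e * k ] ∑[ x < e ] 𝟙 (weight≤h? (x + a * e))
      ≡⟨ ∑-blocks _ e k ⟩
    ∑[ q < e ] ∑[ r < k ] ∑[ x < e ] 𝟙 (weight≤h? (x + (r + q * k) * e))
      ≡⟨ ∑-cong e (λ q _ → ∑-cong k (λ r r<k → ∑-cong e (λ x x<e →
           cong (λ t → 𝟙 (t ≤? h)) (weight-digits q x<e r<k)))) ⟩
    ∑[ q < e ] ∑[ r < k ] ∑[ x < e ] 𝟙 (x + (r + q) ≤? h)
      ≡⟨ ∑-cong e (λ q _ → ∑-cong k (λ r _ → ∑-𝟙-+≤ h (r + q) e)) ⟩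
    ∑[ q < e ] ∑[ r < k ] (e ⊓ (e ∸ (r + q)))
      ≡⟨ ∑-cong e (λ q _ → ∑-cong k (λ r _ → m≥n⇒m⊓n≡n (m∸n≤m e (r + q)))) ⟩
    ∑[ q < e ] ∑[ r < k ] (e ∸ (r + q))
      ≡⟨ ∑-comm _ e k ⟩
    ∑[ r < k ] ∑[ q < e ] (e ∸ (r + q))
      ≡⟨ ∑-cong k (λ r _ → ∑-cong e (λ q _ → ∸-+-assoc e r q)) ⟨
    ∑[ r < k ] ∑[ q < e ] (e ∸ r ∸ q)
      ≡⟨ ∑-cong k (λ r _ → ∑-∸ (m∸n≤m e r)) ⟩
    ∑[ r < k ] (suc (e ∸ r) C 2)
      ∎
    where open ≡-Reasoning

  sumsetCard-A : k ≤ e → sumsetCard h A + (3 + h ∸ k) C 3 ≡ (3 + h) C 3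
  sumsetCard-A k≤e = begin
    sumsetCard h A + (3 + h ∸ k) C 3
      ≡⟨ cong (_+ (3 + h ∸ k) C 3) (trans sumsetCard≡∑ ∑-weight) ⟩
    ∑[ r < k ] (suc (e ∸ r) C 2) + (3 + h ∸ k) C 3
      ≡⟨ cong (_+ (3 + h ∸ k) C 3) (∑-cong k (λ r r<k → cong (_C 2) (+-∸-assoc 1 (<⇒≤ (<-≤-trans r<k k≤e))))) ⟨
    ∑[ r < k ] ((suc e ∸ r) C 2) + (3 + h ∸ k) C 3
      ≡⟨ hockey-stick 1 (suc e) k ⟩
    (3 + h) C 3
      ∎
    where open ≡-Reasoning

private
  cVal-identity : ∀ (i j : ℤ) → let h = + 1 ℤ.+ (i ℤ.+ j) in
    h ℤ.* h ℤ.+ h ℤ.+ + 1 ℤ.- (+ 1 ℤ.+ (i ℤ.- + 1) ℤ.* (h ℤ.+ + 1)) ≡ (+ 2 ℤ.+ j) ℤ.* (+ 2 ℤ.+ (i ℤ.+ j))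
  cVal-identity = ℤ-Solver.solve-∀

setA≡A : ∀ i j → setA (suc (i + j)) i ≡ PlaceValue.A (suc (i + j)) (2 + j)
setA≡A i j = cong (λ c → + 0 ∷ + 1 ∷ + (2 + (i + j)) ∷ c ∷ [])
                  (trans (cVal-identity (+ i) (+ j)) (sym (pos-* (2 + j) (2 + (i + j)))))

mainTheorem1 : (h i₀ : ℕ) → 1 ≤ h → i₀ < h →
    card (setA h i₀) ≡ 4 ×
    sumsetCard h (setA h i₀) ≡ ((h + 3) C 3) ∸ ((i₀ + 2) C 3)
mainTheorem1 h i₀ _ i₀<h with j , refl ← m≤n⇒∃[o]m+o≡n i₀<h =
  subst (λ B → card B ≡ 4 × sumsetCard h B ≡ (h + 3) C 3 ∸ (i₀ + 2) C 3) (sym (setA≡A i₀ j))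
        (card-A (s≤s (s≤s z≤n)) (m<m+n e z<s) ,
         trans (sym (m+n∸n≡m _ ((i₀ + 2) C 3))) (cong (_∸ (i₀ + 2) C 3) sumsetCard+C≡C))
  where
    open PlaceValue (suc (i₀ + j)) (2 + j)

    sumsetCard+C≡C : sumsetCard h A + (i₀ + 2) C 3 ≡ (h + 3) C 3
    sumsetCard+C≡C = begin
      sumsetCard h A + (i₀ + 2) C 3         ≡⟨ cong (λ t → sumsetCard h A + t C 3) (+-comm i₀ 2) ⟩
      sumsetCard h A + (2 + i₀) C 3         ≡⟨ cong (λ t → sumsetCard h A + t C 3) (m+n∸n≡m (2 + i₀) j) ⟨
      sumsetCard h A + (3 + h ∸ (2 + j)) C 3 ≡⟨ sumsetCard-A (s≤s (s≤s (m≤n+m j i₀))) ⟩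
      (3 + h) C 3                           ≡⟨ cong (_C 3) (+-comm 3 h) ⟩
      (h + 3) C 3                           ∎
      where open ≡-Reasoning
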